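{- Let $D$ be an almost bumpless pipe dream of $\pi\in S_n$, and suppose the pipes $p=\pi(x)$ and $q=\pi(y)$ cross exactly once (at a "$+$"-tile $(i,j)$) and bump once (at the bump tile of $D$), where the j-shaped turn in the bump tile belongs to $p$. If we swap the positions of the cross and the bump (replace the tile $(i,j)$ by a bump tile of $p$ and $q$, and the bump tile by a "$+$"-tile of $p$ and $q$, keeping all other tiles), then in the new bump tile at $(i,j)$, the r-shaped turn belongs to $p$.
   Context: A (reduced) bumpless pipe dream (BPD) of size $n$ is a tiling of the $n\times n$ grid (matrix coordinates) by r-tiles (a pipe segment joining the bottom and right edges), j-tiles (a segment joining top and left edges), "$+$"-tiles (two pipes crossing), blank tiles, "$-$"-tiles and "$|$"-tiles, such that there are $n$ pipes, each starting vertically at the south edge and ending horizontally at the east edge (travelling from south to east), and no two pipes cross twice. Labeling pipes $1,\dots,n$ along the south edge left to right and reading labels top to bottom along the east edge gives its permutation $\pi$; the pipe $\pi(x)$ exits in row $x$. A bump tile contains an r-shaped turn (joining bottom and right edges) of one pipe and a j-shaped turn (joining top and left edges) of another pipe, which touch without crossing. An almost bumpless pipe dream of $\pi$ is defined like a BPD of $\pi$ except that exactly one tile is a bump tile (still no two pipes cross twice). -}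

module Defs where

open import Data.Nat using (ℕ; zero; suc; _+_)
open import Data.Fin using (Fin; zero; suc; inject₁; fromℕ; _≟_)
open import Data.Bool using (Bool; true; false)
open import Data.Maybe using (Maybe; just; nothing)
import Data.Maybe as Maybe
open import Data.List using (List; []; _∷_)
open import Data.List.Membership.Propositional using (_∈_)
open import Data.Product using (_×_; _,_; Σ; ∃; proj₁; proj₂)
open import Data.Empty using (⊥)
open import Relation.Nullary using (¬_; yes; no)
open import Relation.Binary.PropositionalEquality using (_≡_)
open import Data.Fin.Permutation using (Permutation′; _⟨$⟩ʳ_)

-- Pipes travel from the south edge to the east edge, i.e. inside
-- a tile they enter through the bottom or the left edge and leave through
-- the top or the right edge.
--   rTile  : bottom → right
--   jTile  : left → top
--   plus   : bottom → top  and  left → right  (two pipes crossing)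
--   blank  : nothing
--   hor    : left → right   ("-" tile)
--   ver    : bottom → top   ("|" tile)
--   bump   : bottom → right (r-turn) and left → top (j-turn), touching

data Tile : Set where
  rTile jTile plus blank hor ver bump : Tile

data Dir : Set where
  fromBottom fromLeft : Dir

data Out : Set where
  toTop toRight : Out

step : Tile → Dir → Maybe Out
step rTile fromBottom = just toRight
step rTile fromLeft   = nothing
step jTile fromBottom = nothing
step jTile fromLeft   = just toTop
step plus  fromBottom = just toTop
step plus  fromLeft   = just toRight
step blank _          = nothing
step hor   fromBottom = nothing
step hor   fromLeft   = just toRight
step ver   fromBottom = just toTop
step ver   fromLeft   = nothing
step bump  fromBottom = just toRight
step bump  fromLeft   = just toTop

hasTop hasBottom hasLeft hasRight : Tile → Bool
hasTop rTile = false
hasTop jTile = true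
hasTop plus  = true
hasTop blank = false
hasTop hor   = false
hasTop ver   = true
hasTop bump  = true
hasBottom rTile = true
hasBottom jTile = false
hasBottom plus  = true
hasBottom blank = false
hasBottom hor   = false
hasBottom ver   = true
hasBottom bump  = true
hasLeft rTile = false
hasLeft jTile = true
hasLeft plus  = true
hasLeft blank = false
hasLeft hor   = true
hasLeft ver   = false
hasLeft bump  = true
hasRight rTile = true
hasRight jTile = false
hasRight plus  = true
hasRight blank = false
hasRight hor   = true
hasRight ver   = false
hasRight bump  = true

-- Grids in matrix coordinates: D i j is the tile in row i (0 = top),
-- column j (0 = left).

Grid : ℕ → Set
Grid n = Fin n → Fin n → Tile

prev : ∀ {n} → Fin n → Maybe (Fin n)
prev zero    = nothing
prev (suc i) = just (inject₁ i)

next : ∀ {n} → Fin n → Maybe (Fin n)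
next {suc zero}    zero    = nothing
next {suc (suc n)} zero    = just (suc zero)
next {suc (suc n)} (suc i) = Maybe.map suc (next i)

lastOf : ∀ {n} → Fin n → Fin n
lastOf {suc n} _ = fromℕ n

record LocallyValid {n : ℕ} (D : Grid n) : Set where
  field
    vertMatch  : ∀ i i′ j → next i ≡ just i′ → hasBottom (D i j) ≡ hasTop (D i′ j)
    horMatch   : ∀ i j j′ → next j ≡ just j′ → hasRight (D i j) ≡ hasLeft (D i j′)
    northEmpty : ∀ i j → prev i ≡ nothing → hasTop (D i j) ≡ false
    southFull  : ∀ i j → next i ≡ nothing → hasBottom (D i j) ≡ true
    westEmpty  : ∀ i j → prev j ≡ nothing → hasLeft (D i j) ≡ false
    eastFull   : ∀ i j → next j ≡ nothing → hasRight (D i j) ≡ true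

-- A visit (i , j , d) records that the pipe passes through
-- tile (i,j) entering from side d.  The result is the list of visits and
-- the row in which the pipe leaves through the east edge (nothing if the
-- pipe gets stuck or leaves through the north edge).

Visit : ℕ → Set
Visit n = Fin n × Fin n × Dir

Trace : ℕ → Set
Trace n = List (Visit n) × Maybe (Fin n)

go : ∀ {n} → Grid n → ℕ → Fin n → Fin n → Dir → Trace n
go D zero    i j d = [] , nothing
go D (suc f) i j d with step (D i j) d
... | nothing      = ((i , j , d) ∷ []) , nothing
... | just toTop   with prev i
...   | nothing = ((i , j , d) ∷ []) , nothing
...   | just i′ = let t = go D f i′ j fromBottom in ((i , j , d) ∷ proj₁ t) , proj₂ t
go D (suc f) i j d | just toRight with next j
...   | nothing = ((i , j , d) ∷ []) , just i
...   | just j′ = let t = go D f i j′ fromLeft in ((i , j , d) ∷ proj₁ t) , proj₂ t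

-- the pipe labelled p enters the grid from the south in column p
-- (labels 0..n-1 left to right); 2n steps of fuel suffice
trace : ∀ {n} → Grid n → Fin n → Trace n
trace {n} D p = go D (n + n) (lastOf p) p fromBottom

PassesVia : ∀ {n} → Grid n → Fin n → Fin n → Fin n → Dir → Set
PassesVia D p i j d = (i , j , d) ∈ proj₁ (trace D p)

Passes : ∀ {n} → Grid n → Fin n → Fin n → Fin n → Set
Passes D p i j = Σ Dir (PassesVia D p i j)

ExitsAt : ∀ {n} → Grid n → Fin n → Fin n → Set
ExitsAt D p x = proj₂ (trace D p) ≡ just x

CrossAt : ∀ {n} → Grid n → Fin n → Fin n → Fin n → Fin n → Set
CrossAt D p q i j = D i j ≡ plus × Passes D p i j × Passes D q i j

NoDoubleCrossing : ∀ {n} → Grid n → Set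
NoDoubleCrossing {n} D =
  ∀ (p q : Fin n) → ¬ (p ≡ q) → ∀ (i j i′ j′ : Fin n) →
    CrossAt D p q i j → CrossAt D p q i′ j′ → (i , j) ≡ (i′ , j′)

ExactlyOneBump : ∀ {n} → Grid n → Set
ExactlyOneBump {n} D =
  Σ (Fin n × Fin n) λ ab → D (proj₁ ab) (proj₂ ab) ≡ bump ×
    (∀ (i j : Fin n) → D i j ≡ bump → (i , j) ≡ ab)

record AlmostBPD {n : ℕ} (D : Grid n) (π : Permutation′ n) : Set where
  field
    valid     : LocallyValid D
    oneBump   : ExactlyOneBump D
    exits     : ∀ x → ExitsAt D (π ⟨$⟩ʳ x) x
    noDouble  : NoDoubleCrossing D

swapCrossBump : ∀ {n} → Grid n → Fin n → Fin n → Fin n → Fin n → Grid n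
swapCrossBump D i j a b r c with r ≟ i | c ≟ j
... | yes _ | yes _ = bump
... | _     | _     with r ≟ a | c ≟ b
...   | yes _ | yes _ = plus
...   | _     | _     = D r c

-- Every move of a pipe goes up or to the right and so raises the level
-- column − row of its tile by one: pipes are deterministic walks graded by
-- level, and visits of equal level in the same row lie in the same tile.
-- If p and q leave a common tile, one upwards and one to the right, the upper
-- one stays strictly above the other until they next share a tile, which it
-- enters from the left and the other from below; that tile is a "+" or a
-- bump, so it does not lie strictly between the crossing (i,j) and the bump
-- (a,b).
-- If the crossing comes first, p cannot enter it from the left (it would be
-- the lower pipe at the next reunion, the bump, where it enters from the
-- left), so it reaches (i,j) from below through tiles the swap leaves alone.
-- If the bump comes first, p leaves it upwards and q to the right, so q
-- enters their next common tile (i,j) from below; after the swap p crosses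
-- straight through (a,b) and follows q's old route into (i,j).
module Submission where

open import Defs
open import Data.Nat using (ℕ; zero; suc; _+_; _∸_; _<_; _≤_; z≤n; s≤s; z<s; pred; >-nonZero)
import Data.Nat as ℕ
open import Data.Nat.Properties
open import Data.Fin using (Fin; zero; suc; toℕ)
import Data.Fin as Fin
open import Data.Fin.Properties using (toℕ-injective; toℕ<n; toℕ-inject₁)
open import Data.Maybe using (just; nothing)
open import Data.List.Membership.Propositional using (_∈_)
open import Data.List.Relation.Unary.Any using (here; there)
open import Data.Product as Product using (_×_; _,_; ∃; proj₁; proj₂)
open import Data.Sum using (_⊎_; inj₁; inj₂)
open import Data.Empty using (⊥; ⊥-elim)
open import Function using (_∘_)
open import Relation.Nullary using (yes; no)
open import Relation.Binary.Definitions using (tri<; tri≈; tri>)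
open import Relation.Binary.PropositionalEquality
open import Data.Fin.Permutation using (Permutation′; _⟨$⟩ʳ_)

private
  variable
    n k K : ℕ
    D D′ : Grid n
    u v w u′ v′ w′ : Visit n

-- column − row, shifted by n to stay in ℕ (rows are < n, so ∸ never truncates)
level : Fin n × Fin n → ℕ
level {n} (r , c) = toℕ c + (n ∸ toℕ r)

cell : Visit n → Fin n × Fin n
cell (r , c , _) = r , c

levelᵛ : Visit n → ℕ
levelᵛ = level ∘ cell

tileAt : Grid n → Visit n → Tile
tileAt D (r , c , _) = D r c

level<n+n : (t : Fin n × Fin n) → level t < n + n
level<n+n {n} (r , c) = +-mono-<-≤ (toℕ<n c) (m∸n≤m n (toℕ r))

prev-toℕ : {i i′ : Fin n} → prev i ≡ just i′ → toℕ i ≡ suc (toℕ i′)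
prev-toℕ {i = suc i} refl = cong suc (sym (toℕ-inject₁ i))

next-toℕ : {j j′ : Fin n} → next j ≡ just j′ → toℕ j′ ≡ suc (toℕ j)
next-toℕ {suc (suc n)} {zero}  refl = refl
next-toℕ {suc (suc n)} {suc j} e with next j in eq | e
... | just _ | refl = cong suc (next-toℕ eq)

n∸m≡1+n∸1+m : ∀ {m n} → m < n → n ∸ m ≡ suc (n ∸ suc m)
n∸m≡1+n∸1+m {m} {n} m<n = begin
  n ∸ m              ≡⟨ sym (suc-pred (n ∸ m) {{>-nonZero (m<n⇒0<n∸m m<n)}}) ⟩
  suc (pred (n ∸ m)) ≡⟨ cong suc (pred[m∸n]≡m∸[1+n] n m) ⟩
  suc (n ∸ suc m)    ∎
  where open ≡-Reasoning

same-level⇒same-column : ∀ {r c c′ : Fin n} → level (r , c) ≡ level (r , c′) → c ≡ c′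
same-level⇒same-column e = toℕ-injective (+-cancelʳ-≡ _ _ _ e)

data Move {n} (D : Grid n) : Visit n → Visit n → Set where
  up    : ∀ {i i′ j d} → step (D i j) d ≡ just toTop → prev i ≡ just i′ →
          Move D (i , j , d) (i′ , j , fromBottom)
  right : ∀ {i j j′ d} → step (D i j) d ≡ just toRight → next j ≡ just j′ →
          Move D (i , j , d) (i , j′ , fromLeft)

data Walk {n} (D : Grid n) : ℕ → Visit n → Visit n → Set where
  []  : Walk D 0 v v
  _∷_ : Move D u v → Walk D k v w → Walk D (suc k) u w

move-step : ∀ {r c d} → Move D (r , c , d) v → ∃ λ o → step (D r c) d ≡ just o
move-step (up e _)    = _ , e
move-step (right e _) = _ , e

move-retarget : ∀ {r c d d′} → step (D′ r c) d′ ≡ step (D r c) d →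
  Move D (r , c , d) v → Move D′ (r , c , d′) v
move-retarget e (up e′ p)    = up (trans e e′) p
move-retarget e (right e′ p) = right (trans e e′) p

move-level : Move D u v → levelᵛ v ≡ suc (levelᵛ u)
move-level {n} (up {i′ = i′} {j} _ p) rewrite prev-toℕ p =
  trans (cong (toℕ j +_) (n∸m≡1+n∸1+m (toℕ<n i′))) (+-suc (toℕ j) _)
move-level {n} (right {i} _ p) = cong (_+ (n ∸ toℕ i)) (next-toℕ p)

move-deterministic : Move D u v → Move D u v′ → v ≡ v′
move-deterministic (up _ p) (up _ p′) with trans (sym p) p′
... | refl = refl
move-deterministic (up e _) (right e′ _) with trans (sym e) e′
... | ()
move-deterministic (right e _) (up e′ _) with trans (sym e) e′
... | ()
move-deterministic (right _ p) (right _ p′) with trans (sym p) p′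
... | refl = refl

walk-level : Walk D k u w → levelᵛ w ≡ levelᵛ u + k
walk-level {u = u} [] = sym (+-identityʳ (levelᵛ u))
walk-level {k = suc k} {u = u} (m ∷ W) = begin
  _                        ≡⟨ walk-level W ⟩
  _ + k                    ≡⟨ cong (_+ k) (move-level m) ⟩
  suc (levelᵛ u) + k       ≡⟨ sym (+-suc (levelᵛ u) k) ⟩
  levelᵛ u + suc k         ∎
  where open ≡-Reasoning

walk-level-< : Walk D (suc k) u w → levelᵛ u < levelᵛ w
walk-level-< {u = u} W = subst (levelᵛ u <_) (sym (walk-level W)) (m<m+n (levelᵛ u) z<s)

walk-zero : Walk D 0 u w → u ≡ w
walk-zero [] = refl

walk-deterministic : Walk D k u v → Walk D k u v′ → v ≡ v′
walk-deterministic []      []      = refl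
walk-deterministic (m ∷ V) (m′ ∷ V′) with move-deterministic m m′
... | refl = walk-deterministic V V′

_++ʷ_ : ∀ {k′} → Walk D k u v → Walk D k′ v w → Walk D (k + k′) u w
[]      ++ʷ W = W
(m ∷ V) ++ʷ W = m ∷ (V ++ʷ W)

splitAt : ∀ m → Walk D (m + k) u w → ∃ λ v → Walk D m u v × Walk D k v w
splitAt zero    W       = _ , [] , W
splitAt (suc m) (x ∷ W) = Product.map₂ (Product.map₁ (x ∷_)) (splitAt m W)

walk-lengths : ∀ {k₁ k₂ s} → Walk D k₁ s v → Walk D k₂ s w →
  levelᵛ v + K ≡ levelᵛ w → k₂ ≡ k₁ + K
walk-lengths {K = K} {k₁ = k₁} {k₂} {s} V W e = +-cancelˡ-≡ (levelᵛ s) _ _ (begin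
  levelᵛ s + k₂         ≡⟨ sym (walk-level W) ⟩
  _                     ≡⟨ sym e ⟩
  _ + K                 ≡⟨ cong (_+ K) (walk-level V) ⟩
  levelᵛ s + k₁ + K     ≡⟨ +-assoc (levelᵛ s) k₁ K ⟩
  levelᵛ s + (k₁ + K)   ∎)
  where open ≡-Reasoning

walk-between : ∀ {k₁ k₂ s} → Walk D k₁ s v → Walk D k₂ s w →
  levelᵛ v + K ≡ levelᵛ w → Walk D K v w
walk-between {D = D} {k₁ = k₁} {s = s} V W e
  with splitAt k₁ (subst (λ k → Walk D k s _) (walk-lengths V W e) W)
... | _ , V′ , U with walk-deterministic V′ V
... | refl = U

AgreeBetween : Grid n → Grid n → ℕ → ℕ → Set
AgreeBetween D D′ lo hi = ∀ r c → lo ≤ level (r , c) → level (r , c) < hi → D′ r c ≡ D r c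

walk-transport : ∀ {lo hi} → AgreeBetween D D′ lo hi →
  lo ≤ levelᵛ u → levelᵛ w ≤ hi → Walk D k u w → Walk D′ k u w
walk-transport agree lo≤u w≤hi [] = []
walk-transport {u = r , c , d} agree lo≤u w≤hi (m ∷ W) =
  move-retarget (cong (λ t → step t d) (agree r c lo≤u (<-≤-trans (walk-level-< (m ∷ W)) w≤hi))) m
  ∷ walk-transport agree (≤-trans lo≤u (≤-trans (n≤1+n _) (≤-reflexive (sym (move-level m)))))
                   w≤hi W

∈go⇒walk : ∀ f i j d → v ∈ proj₁ (go D f i j d) → ∃ λ k → Walk D k (i , j , d) v
∈go⇒walk {D = D} (suc f) i j d v∈ with step (D i j) d in e
∈go⇒walk (suc f) i j d (here refl) | nothing = 0 , []
∈go⇒walk (suc f) i j d v∈ | just toTop with prev i in e′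
∈go⇒walk (suc f) i j d (here refl) | just toTop | nothing = 0 , []
∈go⇒walk (suc f) i j d (here refl) | just toTop | just _  = 0 , []
∈go⇒walk (suc f) i j d (there v∈) | just toTop | just i′ =
  Product.map suc (up e e′ ∷_) (∈go⇒walk f i′ j fromBottom v∈)
∈go⇒walk (suc f) i j d v∈ | just toRight with next j in e′
∈go⇒walk (suc f) i j d (here refl) | just toRight | nothing = 0 , []
∈go⇒walk (suc f) i j d (here refl) | just toRight | just _  = 0 , []
∈go⇒walk (suc f) i j d (there v∈) | just toRight | just j′ =
  Product.map suc (right e e′ ∷_) (∈go⇒walk f i j′ fromLeft v∈)

walk⇒∈go : ∀ f i j d → Walk D k (i , j , d) v → k < f → v ∈ proj₁ (go D f i j d)
walk⇒∈go {D = D} (suc f) i j d [] _ with step (D i j) d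
... | nothing = here refl
... | just toTop with prev i
...   | nothing = here refl
...   | just _  = here refl
walk⇒∈go {D = D} (suc f) i j d [] _ | just toRight with next j
...   | nothing = here refl
...   | just _  = here refl
walk⇒∈go {D = D} (suc f) i j d (up e p ∷ W) (s≤s k<f) with step (D i j) d | e
... | just toTop | refl with prev i | p
...   | just i′ | refl = there (walk⇒∈go f i′ j fromBottom W k<f)
walk⇒∈go {D = D} (suc f) i j d (right e p ∷ W) (s≤s k<f) with step (D i j) d | e
... | just toRight | refl with next j | p
...   | just j′ | refl = there (walk⇒∈go f i j′ fromLeft W k<f)

source : Fin n → Visit n
source p = lastOf p , p , fromBottom

Reaches : Grid n → Fin n → Visit n → Set
Reaches D p v = ∃ λ k → Walk D k (source p) v

passesVia⇒reaches : ∀ {p i j d} → PassesVia D p i j d → Reaches D p (i , j , d)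
passesVia⇒reaches {n} = ∈go⇒walk (n + n) _ _ _

-- A walk is no longer than the level of its end, which is below the fuel n + n of trace.
reaches⇒passesVia : ∀ {p i j d} → Reaches D p (i , j , d) → PassesVia D p i j d
reaches⇒passesVia {n} {i = i} {j} (k , W) = walk⇒∈go (n + n) _ _ _ W
  (≤-<-trans (m≤n+m k _) (subst (_< n + n) (walk-level W) (level<n+n (i , j))))

reaches-++ : ∀ {p} → Reaches D p u → Walk D k u v → Reaches D p v
reaches-++ (_ , U) W = _ , U ++ʷ W

reaches-transport : ∀ {p} → AgreeBetween D D′ 0 (levelᵛ v) → Reaches D p v → Reaches D′ p v
reaches-transport agree (k , W) = k , walk-transport agree z≤n ≤-refl W

two-way-tile : ∀ t {o o′} → step t fromLeft ≡ just o → step t fromBottom ≡ just o′ →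
  t ≡ plus ⊎ t ≡ bump
two-way-tile plus  _  _  = inj₁ refl
two-way-tile bump  _  _  = inj₂ refl
two-way-tile rTile () _
two-way-tile jTile _  ()
two-way-tile blank () _
two-way-tile hor   _  ()
two-way-tile ver   () _

record Reunion {n} (D : Grid n) (u w u′ w′ : Visit n) : Set where
  constructor reunion
  field
    row col        : Fin n
    len-in len-out : ℕ
    upper-in       : Walk D (suc len-in) u (row , col , fromLeft)
    upper-out      : Walk D len-out (row , col , fromLeft) w
    lower-in       : Walk D (suc len-in) u′ (row , col , fromBottom)
    lower-out      : Walk D len-out (row , col , fromBottom) w′

reunion-∷ : ∀ {u₀ u₀′} → Move D u₀ u → Move D u₀′ u′ →
  Reunion D u w u′ w′ → Reunion D u₀ w u₀′ w′
reunion-∷ x y (reunion r c m k uin uout lin lout) = reunion r c (suc m) k (x ∷ uin) uout (y ∷ lin) lout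

same-level-after : Move D u v → Move D u′ v′ →
  levelᵛ u ≡ levelᵛ u′ → levelᵛ v ≡ levelᵛ v′
same-level-after x y e = trans (move-level x) (trans (cong suc e) (sym (move-level y)))

reunite : ∀ {iU jU dU iR jR dR} →
  Walk D K (iU , jU , dU) w → Walk D K (iR , jR , dR) w′ →
  level (iU , jU) ≡ level (iR , jR) → toℕ iU < toℕ iR → cell w ≡ cell w′ →
  Reunion D (iU , jU , dU) w (iR , jR , dR) w′
reunite [] [] _ iU<iR same = ⊥-elim (<-irrefl (cong (toℕ ∘ proj₁) same) iU<iR)
reunite (x@(right _ _) ∷ U) (y@(right _ _) ∷ R) e iU<iR same =
  reunion-∷ x y (reunite U R (same-level-after x y e) iU<iR same)
reunite (x@(up _ pU) ∷ U) (y@(up _ pR) ∷ R) e iU<iR same =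
  reunion-∷ x y (reunite U R (same-level-after x y e)
    (≤-pred (subst₂ _<_ (prev-toℕ pU) (prev-toℕ pR) iU<iR)) same)
reunite (x@(up _ pU) ∷ U) (y@(right _ _) ∷ R) e iU<iR same =
  reunion-∷ x y (reunite U R (same-level-after x y e)
    (<-trans (subst (_ <_) (sym (prev-toℕ pU)) (n<1+n _)) iU<iR) same)
reunite {iU = iU} {jR = jR}
        (x@(right {j′ = jU′} _ _) ∷ U) (y@(up {i′ = iR′} _ pR) ∷ R) e iU<iR same
  with toℕ iU ℕ.≟ toℕ iR′
... | no iU≢iR′ = reunion-∷ x y (reunite U R (same-level-after x y e)
        (≤∧≢⇒< (≤-pred (subst (_ <_) (prev-toℕ pR) iU<iR)) iU≢iR′) same)
... | yes iU≡iR′ with toℕ-injective iU≡iR′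
...   | refl with same-level⇒same-column {r = iU} {jU′} {jR} (same-level-after x y e)
...     | refl = reunion _ _ 0 _ (x ∷ []) U (y ∷ []) R

reunion-after-fork : ∀ {r c d d′} →
  step (D r c) d ≡ just toTop → step (D r c) d′ ≡ just toRight →
  Walk D (suc K) (r , c , d) w → Walk D (suc K) (r , c , d′) w′ → cell w ≡ cell w′ →
  Reunion D (r , c , d) w (r , c , d′) w′
reunion-after-fork _ _ (x@(up _ p) ∷ U) (y@(right _ _) ∷ R) same =
  reunion-∷ x y (reunite U R (same-level-after x y refl)
    (subst (_ <_) (sym (prev-toℕ p)) (n<1+n _)) same)
reunion-after-fork goesUp _ (right e _ ∷ _) _ _ with trans (sym goesUp) e
... | ()
reunion-after-fork _ goesRight (up _ _ ∷ _) (up e _ ∷ _) _ with trans (sym goesRight) e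
... | ()

swapCrossBump-at-bump : ∀ (D : Grid n) i j a b → (a , b) ≢ (i , j) →
  swapCrossBump D i j a b a b ≡ plus
swapCrossBump-at-bump D i j a b ab≢ij with a Fin.≟ i | b Fin.≟ j
... | yes refl | yes refl = ⊥-elim (ab≢ij refl)
... | yes _ | no _ with a Fin.≟ a | b Fin.≟ b
...   | yes _ | yes _  = refl
...   | no a≢a | _     = ⊥-elim (a≢a refl)
...   | yes _ | no b≢b = ⊥-elim (b≢b refl)
swapCrossBump-at-bump D i j a b ab≢ij | no _ | _ with a Fin.≟ a | b Fin.≟ b
...   | yes _ | yes _  = refl
...   | no a≢a | _     = ⊥-elim (a≢a refl)
...   | yes _ | no b≢b = ⊥-elim (b≢b refl)

swapCrossBump-elsewhere : ∀ (D : Grid n) {i j a b r c} → (r , c) ≢ (i , j) → (r , c) ≢ (a , b) →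
  swapCrossBump D i j a b r c ≡ D r c
swapCrossBump-elsewhere D {i} {j} {a} {b} {r} {c} rc≢ij rc≢ab with r Fin.≟ i | c Fin.≟ j
... | yes refl | yes refl = ⊥-elim (rc≢ij refl)
... | yes _ | no _ with r Fin.≟ a | c Fin.≟ b
...   | yes refl | yes refl = ⊥-elim (rc≢ab refl)
...   | yes _ | no _ = refl
...   | no _ | _     = refl
swapCrossBump-elsewhere D {i} {j} {a} {b} {r} {c} rc≢ij rc≢ab | no _ | _ with r Fin.≟ a | c Fin.≟ b
...   | yes refl | yes refl = ⊥-elim (rc≢ab refl)
...   | yes _ | no _ = refl
...   | no _ | _     = refl

m<n⇒∃[o]m+suc[o]≡n : ∀ {m n} → m < n → ∃ λ o → m + suc o ≡ n
m<n⇒∃[o]m+suc[o]≡n {m} m<n = Product.map₂ (trans (+-suc m _)) (m≤n⇒∃[o]m+o≡n m<n)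

module CrossBumpSwap {n} (D : Grid n) (p q i j a b : Fin n)
  (plus-at-ij : D i j ≡ plus) (bump-at-ab : D a b ≡ bump)
  (only-crossing : ∀ r c → CrossAt D p q r c → (r , c) ≡ (i , j))
  (only-bump : ∀ r c → D r c ≡ bump → (r , c) ≡ (a , b))
  (p-at-ab : Reaches D p (a , b , fromLeft)) (q-at-ab : Reaches D q (a , b , fromBottom))
  where

  swapped : Grid n
  swapped = swapCrossBump D i j a b

  unchanged : ∀ r c → level (r , c) ≢ level (i , j) → level (r , c) ≢ level (a , b) →
    swapped r c ≡ D r c
  unchanged r c ≢ij ≢ab = swapCrossBump-elsewhere D (≢ij ∘ cong level) (≢ab ∘ cong level)

  no-other-meeting : ∀ {r c d d′ o o′} →
    step (D r c) fromLeft ≡ just o → step (D r c) fromBottom ≡ just o′ →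
    Reaches D p (r , c , d) → Reaches D q (r , c , d′) →
    level (r , c) ≢ level (i , j) → level (r , c) ≢ level (a , b) → ⊥
  no-other-meeting {r} {c} left bottom p-rc q-rc ≢ij ≢ab with two-way-tile (D r c) left bottom
  ... | inj₁ is-plus = ≢ij (cong level (only-crossing r c
          (is-plus , (_ , reaches⇒passesVia p-rc) , (_ , reaches⇒passesVia q-rc))))
  ... | inj₂ is-bump = ≢ab (cong level (only-bump r c is-bump))

  crossing-level≢bump-level : ∀ {d} → Reaches D p (i , j , d) → level (i , j) ≢ level (a , b)
  crossing-level≢bump-level p-ij e
    with walk-zero (walk-between (proj₂ p-ij) (proj₂ p-at-ab) (trans (+-identityʳ _) e))
  ... | same with trans (sym plus-at-ij) (trans (cong (tileAt D) same) bump-at-ab)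
  ...   | ()

  crossing-first : level (i , j) < level (a , b) →
    Reaches D p (i , j , fromBottom) → Reaches swapped p (i , j , fromBottom)
  crossing-first ij<ab = reaches-transport λ r c _ <ij →
    unchanged r c (<⇒≢ <ij) (<⇒≢ (<-trans <ij ij<ab))

  crossing-first-not-from-left : ∀ d → level (i , j) < level (a , b) →
    Reaches D p (i , j , fromLeft) → Reaches D q (i , j , d) → ⊥
  crossing-first-not-from-left d ij<ab p-ij q-ij
    with m<n⇒∃[o]m+suc[o]≡n ij<ab
  ... | _ , gap with walk-between (proj₂ p-ij) (proj₂ p-at-ab) gap
                   | walk-between (proj₂ q-ij) (proj₂ q-at-ab) gap
  crossing-first-not-from-left fromLeft ij<ab p-ij q-ij | _ , gap | p-walk | q-walk
    with walk-deterministic p-walk q-walk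
  ... | ()
  crossing-first-not-from-left fromBottom ij<ab p-ij q-ij | _ , gap | p-walk | q-walk
    with reunion-after-fork (cong (λ t → step t fromBottom) plus-at-ij)
                            (cong (λ t → step t fromLeft) plus-at-ij) q-walk p-walk refl
  ... | reunion _ _ _ (suc _) q-in (x ∷ _) p-in (y ∷ Y) =
    no-other-meeting (proj₂ (move-step x)) (proj₂ (move-step y))
      (reaches-++ p-ij p-in) (reaches-++ q-ij q-in)
      (>⇒≢ (walk-level-< p-in)) (<⇒≢ (walk-level-< (y ∷ Y)))

  bump-first : ∀ {d d′} → level (a , b) < level (i , j) →
    Reaches D p (i , j , d) → Reaches D q (i , j , d′) → Reaches swapped p (i , j , fromBottom)
  bump-first ab<ij p-ij q-ij with m<n⇒∃[o]m+suc[o]≡n ab<ij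
  ... | _ , gap with reunion-after-fork (cong (λ t → step t fromLeft) bump-at-ab)
                                       (cong (λ t → step t fromBottom) bump-at-ab)
                                       (walk-between (proj₂ p-at-ab) (proj₂ p-ij) gap)
                                       (walk-between (proj₂ q-at-ab) (proj₂ q-ij) gap) refl
  ... | reunion _ _ _ (suc _) p-in (x ∷ X) q-in (y ∷ _) = ⊥-elim
    (no-other-meeting (proj₂ (move-step x)) (proj₂ (move-step y))
      (reaches-++ p-at-ab p-in) (reaches-++ q-at-ab q-in)
      (<⇒≢ (walk-level-< (x ∷ X))) (>⇒≢ (walk-level-< p-in)))
  ... | reunion _ _ _ zero _ [] (y ∷ q-rest) [] =
    reaches-++ (reaches-transport before-bump p-at-ab)
      (move-retarget crosses-at-ab y ∷
       walk-transport after-bump (≤-reflexive (sym (move-level y))) ≤-refl q-rest)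
    where
    before-bump : AgreeBetween D swapped 0 (level (a , b))
    before-bump r c _ <ab = unchanged r c (<⇒≢ (<-trans <ab ab<ij)) (<⇒≢ <ab)

    after-bump : AgreeBetween D swapped (suc (level (a , b))) (level (i , j))
    after-bump r c ab< <ij = unchanged r c (<⇒≢ <ij) (>⇒≢ ab<)

    crosses-at-ab : step (swapped a b) fromLeft ≡ step (D a b) fromBottom
    crosses-at-ab =
      trans (cong (λ t → step t fromLeft) (swapCrossBump-at-bump D i j a b (<⇒≢ ab<ij ∘ cong level)))
            (sym (cong (λ t → step t fromBottom) bump-at-ab))

  p-enters-crossing-from-below : ∀ d d′ →
    Reaches D p (i , j , d) → Reaches D q (i , j , d′) → Reaches swapped p (i , j , fromBottom)
  p-enters-crossing-from-below d d′ p-ij q-ij with <-cmp (level (i , j)) (level (a , b))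
  ... | tri≈ _ ij≡ab _ = ⊥-elim (crossing-level≢bump-level p-ij ij≡ab)
  ... | tri> _ _ ab<ij = bump-first ab<ij p-ij q-ij
  p-enters-crossing-from-below fromBottom d′ p-ij q-ij | tri< ij<ab _ _ = crossing-first ij<ab p-ij
  p-enters-crossing-from-below fromLeft   d′ p-ij q-ij | tri< ij<ab _ _ =
    ⊥-elim (crossing-first-not-from-left d′ ij<ab p-ij q-ij)

mainTheorem5 : (n : ℕ) (D : Grid n) (π : Permutation′ n) → AlmostBPD D π →
    (x y : Fin n) → (i j a b : Fin n) →
    -- the bump tile of D is (a,b)
    D a b ≡ bump →
    -- p = π(x) and q = π(y) cross exactly once, at (i,j)
    CrossAt D (π ⟨$⟩ʳ x) (π ⟨$⟩ʳ y) i j →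
    (∀ (i′ j′ : Fin n) → CrossAt D (π ⟨$⟩ʳ x) (π ⟨$⟩ʳ y) i′ j′ → (i′ , j′) ≡ (i , j)) →
    -- they bump at (a,b), the j-turn (entering from the left) being p's
    PassesVia D (π ⟨$⟩ʳ x) a b fromLeft →
    PassesVia D (π ⟨$⟩ʳ y) a b fromBottom →
    -- after swapping, the r-turn (entering from the bottom) at (i,j) is p's
    PassesVia (swapCrossBump D i j a b) (π ⟨$⟩ʳ x) i j fromBottom
mainTheorem5 n D π A x y i j a b bump-at-ab (plus-at-ij , (d , p-ij) , (d′ , q-ij))
             only-crossing p-ab q-ab =
  reaches⇒passesVia
    (CrossBumpSwap.p-enters-crossing-from-below D (π ⟨$⟩ʳ x) (π ⟨$⟩ʳ y) i j a b
      plus-at-ij bump-at-ab only-crossing only-bump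
      (passesVia⇒reaches p-ab) (passesVia⇒reaches q-ab)
      d d′ (passesVia⇒reaches p-ij) (passesVia⇒reaches q-ij))
  where
  only-bump : ∀ r c → D r c ≡ bump → (r , c) ≡ (a , b)
  only-bump r c is-bump with AlmostBPD.oneBump A
  ... | _ , _ , unique = trans (unique r c is-bump) (sym (unique a b bump-at-ab))
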